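{- $\overrightarrow{\nu}(K_2)=1$.
   Context: For a digraph $D$ with vertex set $\{1,\dots,n\}$, $Q(D)$ is the set of real $n\times n$ matrices $B=[b_{u,w}]$ with $b_{u,u}\neq 0$ for all $u$, $b_{u,w}\neq 0$ if $u\neq w$ and there is an arc from $u$ to $w$, and $b_{u,w}=0$ if $u\neq w$ and there is no arc from $u$ to $w$. A matrix $B\in Q(D)$ has the Asymmetric Strong Arnold Property (ASAP) if the only real $n\times n$ matrix $X$ with $X\circ B=0$ (entrywise product), $X^TB=0$ and $BX^T=0$ is $X=0$. $\overrightarrow{\nu}(D)$ is the largest nullity of a matrix $B\in Q(D)$ having the ASAP. $K_2$ is the digraph on two vertices with an arc in each direction between them. -}

module Defs where

open import Level using (Level; _⊔_) renaming (suc to lsuc)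
open import Algebra.Bundles using (CommutativeRing)
open import Data.Nat using (ℕ; zero; suc)
open import Data.Fin using (Fin; zero; suc)
open import Data.Product using (Σ; ∃; _×_; _,_)
open import Relation.Nullary using (¬_)
open import Relation.Binary.PropositionalEquality using (_≡_)

record Field (c ℓ : Level) : Set (lsuc (c ⊔ ℓ)) where
  field
    commutativeRing : CommutativeRing c ℓ
  open CommutativeRing commutativeRing public
  field
    0≉1 : ¬ (0# ≈ 1#)
    inverse : ∀ x → ¬ (x ≈ 0#) → ∃ λ y → x * y ≈ 1#

-- A digraph on vertex set Fin n (loops are irrelevant for Q(D)).
record Digraph (n : ℕ) : Set₁ where
  field
    Arc : Fin n → Fin n → Set

K₂ : Digraph 2
K₂ = record { Arc = λ u w → ¬ (u ≡ w) }

module _ {c ℓ : Level} (F : Field c ℓ) where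
  open Field F using (Carrier; _≈_; _+_; _*_; 0#)

  Matrix : ℕ → Set c
  Matrix n = Fin n → Fin n → Carrier

  Vector : ℕ → Set c
  Vector n = Fin n → Carrier

  ∑ : ∀ {n} → (Fin n → Carrier) → Carrier
  ∑ {zero}  f = 0#
  ∑ {suc n} f = f zero + ∑ (λ i → f (suc i))

  InQ : ∀ {n} → Digraph n → Matrix n → Set ℓ
  InQ {n} D B =
      (∀ u → ¬ (B u u ≈ 0#))
    × (∀ u w → ¬ (u ≡ w) → Digraph.Arc D u w → ¬ (B u w ≈ 0#))
    × (∀ u w → ¬ (u ≡ w) → ¬ Digraph.Arc D u w → B u w ≈ 0#)

  ASAP : ∀ {n} → Matrix n → Set (c ⊔ ℓ)
  ASAP {n} B =
    ∀ (X : Matrix n) →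
      (∀ u w → X u w * B u w ≈ 0#) →
      (∀ u w → ∑ (λ k → X k u * B k w) ≈ 0#) →
      (∀ u w → ∑ (λ k → B u k * X w k) ≈ 0#) →
      ∀ u w → X u w ≈ 0#

  InKernel : ∀ {n} → Matrix n → Vector n → Set ℓ
  InKernel B v = ∀ u → ∑ (λ w → B u w * v w) ≈ 0#

  LinearlyIndependent : ∀ {n k} → (Fin k → Vector n) → Set (c ⊔ ℓ)
  LinearlyIndependent {n} {k} vs =
    ∀ (a : Fin k → Carrier) →
      (∀ u → ∑ (λ i → a i * vs i u) ≈ 0#) → ∀ i → a i ≈ 0#

  NullityAtLeast : ∀ {n} → ℕ → Matrix n → Set (c ⊔ ℓ)
  NullityAtLeast {n} k B =
    Σ (Fin k → Vector n) λ vs → (∀ i → InKernel B (vs i)) × LinearlyIndependent vs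

  Nullity : ∀ {n} → Matrix n → ℕ → Set (c ⊔ ℓ)
  Nullity B k = NullityAtLeast k B × ¬ NullityAtLeast (suc k) B

  ArrowNu≡ : ∀ {n} → Digraph n → ℕ → Set (c ⊔ ℓ)
  ArrowNu≡ {n} D k =
      (Σ (Matrix n) λ B → InQ D B × ASAP B × Nullity B k)
    × (∀ (B : Matrix n) → InQ D B → ASAP B → ¬ NullityAtLeast (suc k) B)

{-# OPTIONS --safe #-}
-- Every matrix in Q(K₂) has nonzero diagonal, so its first row is a nonzero
-- functional and its null space lies on a line: any two null vectors are
-- dependent and the nullity is at most 1. The all-ones matrix attains 1: it
-- is in Q(K₂), (1, -1) is a null vector, and having no zero entry,
-- X ∘ J = 0 already forces X = 0, so it has the ASAP.
module Submission where

open import Defs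
open import Level using (Level; _⊔_)
open import Data.Nat using (zero; suc)
open import Data.Fin using (Fin; zero; suc; _≟_)
open import Data.Product using (∃; _,_)
open import Relation.Nullary using (¬_; yes; no; contradiction)
import Relation.Binary.PropositionalEquality as ≡
import Algebra.Properties.CommutativeSemigroup as CommutativeSemigroupProperties
import Algebra.Properties.Group as GroupProperties
import Algebra.Properties.Ring as RingProperties
import Relation.Binary.Reasoning.Setoid as SetoidReasoning

module _ {c ℓ : Level} (F : Field c ℓ) where
  open Field F hiding (zero)
  open CommutativeSemigroupProperties *-commutativeSemigroup using (x∙yz≈y∙xz; x∙yz≈z∙xy)
  open GroupProperties +-group using (inverseˡ-unique)
  open RingProperties ring using (-‿distribˡ-*; -‿distribʳ-*)
  open SetoidReasoning setoid

  1≉0 : ¬ (1# ≈ 0#)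
  1≉0 1≈0 = 0≉1 (sym 1≈0)

  y≉0⇒x*y≈0⇒x≈0 : ∀ {x y} → ¬ (y ≈ 0#) → x * y ≈ 0# → x ≈ 0#
  y≉0⇒x*y≈0⇒x≈0 {x} {y} y≉0 xy≈0 with inverse y y≉0
  ... | z , yz≈1 = begin
    x           ≈⟨ sym (*-identityʳ x) ⟩
    x * 1#      ≈⟨ *-congˡ (sym yz≈1) ⟩
    x * (y * z) ≈⟨ sym (*-assoc x y z) ⟩
    x * y * z   ≈⟨ *-congʳ xy≈0 ⟩
    0# * z      ≈⟨ zeroˡ z ⟩
    0#          ∎

  ∑-zero : ∀ {n} {f : Fin n → Carrier} → (∀ i → f i ≈ 0#) → ∑ F f ≈ 0#
  ∑-zero {zero}  f≈0 = refl
  ∑-zero {suc n} f≈0 = trans (+-cong (f≈0 zero) (∑-zero (λ i → f≈0 (suc i)))) (+-identityʳ 0#)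

  ∑₁ : (f : Fin 1 → Carrier) → ∑ F f ≈ f zero
  ∑₁ f = +-identityʳ (f zero)

  ∑₂ : (f : Fin 2 → Carrier) → ∑ F f ≈ f zero + f (suc zero)
  ∑₂ f = +-congˡ (+-identityʳ (f (suc zero)))

  nowhereZero⇒ASAP : ∀ {n} (B : Matrix F n) → (∀ u w → ¬ (B u w ≈ 0#)) → ASAP F B
  nowhereZero⇒ASAP B B≉0 X X∘B≈0 _ _ u w = y≉0⇒x*y≈0⇒x≈0 (B≉0 u w) (X∘B≈0 u w)

  nonzero⇒linearlyIndependent : ∀ {n} (v : Vector F n) u → ¬ (v u ≈ 0#) →
                                LinearlyIndependent F (λ (_ : Fin 1) → v)
  nonzero⇒linearlyIndependent v u vu≉0 a combination≈0 zero =
    y≉0⇒x*y≈0⇒x≈0 vu≉0 (trans (sym (∑₁ (λ i → a i * v u))) (combination≈0 u))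

  linearlyIndependent⇒nonzero : ∀ {n k} {vs : Fin k → Vector F n} →
                                LinearlyIndependent F vs → ∀ i → ¬ (∀ u → vs i u ≈ 0#)
  linearlyIndependent⇒nonzero {vs = vs} independent i vsᵢ≈0 =
    indicatorᵢᵢ≉0 (independent indicator (λ u → ∑-zero (term≈0 u)) i)
    where
    indicator : Fin _ → Carrier
    indicator j with i ≟ j
    ... | yes _ = 1#
    ... | no  _ = 0#

    indicatorᵢᵢ≉0 : ¬ (indicator i ≈ 0#)
    indicatorᵢᵢ≉0 with i ≟ i
    ... | yes _  = 1≉0
    ... | no i≢i = contradiction ≡.refl i≢i

    term≈0 : ∀ u j → indicator j * vs j u ≈ 0#
    term≈0 u j with i ≟ j
    ... | yes ≡.refl = trans (*-identityˡ _) (vsᵢ≈0 u)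
    ... | no  _      = zeroˡ _

  Multiple : ∀ {n} → Vector F n → Vector F n → Set (c ⊔ ℓ)
  Multiple w v = ∃ λ s → ∀ u → v u ≈ s * w u

  multiples⇒¬linearlyIndependent : ∀ {n} (w : Vector F n) (vs : Fin 2 → Vector F n) →
                                   Multiple w (vs zero) → Multiple w (vs (suc zero)) →
                                   ¬ LinearlyIndependent F vs
  multiples⇒¬linearlyIndependent w vs (s₀ , vs₀≈s₀w) (s₁ , vs₁≈s₁w) independent =
    linearlyIndependent⇒nonzero {vs = vs} independent zero vs₀≈0
    where
    a : Fin 2 → Carrier
    a zero       = - s₁
    a (suc zero) = s₀

    combination≈0 : ∀ u → ∑ F (λ i → a i * vs i u) ≈ 0#
    combination≈0 u = begin
      ∑ F (λ i → a i * vs i u)                  ≈⟨ ∑₂ (λ i → a i * vs i u) ⟩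
      - s₁ * vs zero u + s₀ * vs (suc zero) u    ≈⟨ +-cong (*-congˡ (vs₀≈s₀w u)) (*-congˡ (vs₁≈s₁w u)) ⟩
      - s₁ * (s₀ * w u) + s₀ * (s₁ * w u)        ≈⟨ +-cong (sym (-‿distribˡ-* s₁ _)) (x∙yz≈y∙xz s₀ s₁ (w u)) ⟩
      - (s₁ * (s₀ * w u)) + s₁ * (s₀ * w u)      ≈⟨ -‿inverseˡ _ ⟩
      0#                                         ∎

    vs₀≈0 : ∀ u → vs zero u ≈ 0#
    vs₀≈0 u = begin
      vs zero u ≈⟨ vs₀≈s₀w u ⟩
      s₀ * w u  ≈⟨ *-congʳ (independent a combination≈0 (suc zero)) ⟩
      0# * w u  ≈⟨ zeroˡ (w u) ⟩
      0#        ∎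

  -- (-b₀₁ / b₀₀, 1), where y is an inverse of b₀₀
  kernelDirection : Matrix F 2 → Carrier → Vector F 2
  kernelDirection B y zero       = - (y * B zero (suc zero))
  kernelDirection B y (suc zero) = 1#

  kernel⊆line : (B : Matrix F 2) {y : Carrier} → B zero zero * y ≈ 1# →
                ∀ {v} → InKernel F B v → Multiple (kernelDirection B y) v
  kernel⊆line B {y} b₀₀y≈1 {v} Bv≈0 = v₁ , on-line
    where
    b₀₀ = B zero zero
    b₀₁ = B zero (suc zero)
    v₀ = v zero
    v₁ = v (suc zero)

    on-line : ∀ u → v u ≈ v₁ * kernelDirection B y u
    on-line (suc zero) = sym (*-identityʳ v₁)
    on-line zero = begin
      v₀                ≈⟨ sym (*-identityˡ v₀) ⟩
      1# * v₀           ≈⟨ *-congʳ (trans (sym b₀₀y≈1) (*-comm b₀₀ y)) ⟩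
      y * b₀₀ * v₀      ≈⟨ *-assoc y b₀₀ v₀ ⟩
      y * (b₀₀ * v₀)    ≈⟨ *-congˡ (inverseˡ-unique _ _ (trans (sym (∑₂ (λ j → B zero j * v j))) (Bv≈0 zero))) ⟩
      y * - (b₀₁ * v₁)  ≈⟨ sym (-‿distribʳ-* y _) ⟩
      - (y * (b₀₁ * v₁)) ≈⟨ -‿cong (x∙yz≈z∙xy y b₀₁ v₁) ⟩
      - (v₁ * (y * b₀₁)) ≈⟨ -‿distribʳ-* v₁ _ ⟩
      v₁ * - (y * b₀₁)  ∎

  nullity<2 : (B : Matrix F 2) → ¬ (B zero zero ≈ 0#) → ¬ NullityAtLeast F 2 B
  nullity<2 B b₀₀≉0 (vs , inKernel , independent) with inverse (B zero zero) b₀₀≉0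
  ... | y , b₀₀y≈1 =
    multiples⇒¬linearlyIndependent _ vs (kernel⊆line B b₀₀y≈1 (inKernel zero))
                                        (kernel⊆line B b₀₀y≈1 (inKernel (suc zero))) independent

  J : Matrix F 2
  J _ _ = 1#

  J∈Q[K₂] : InQ F K₂ J
  J∈Q[K₂] = (λ _ → 1≉0) , (λ _ _ _ _ → 1≉0) , (λ _ _ u≢w ¬arc → contradiction u≢w ¬arc)

  J-nullity≥1 : NullityAtLeast F 1 J
  J-nullity≥1 = (λ _ → v) , (λ _ → Jv≈0) , nonzero⇒linearlyIndependent v zero 1≉0
    where
    v : Vector F 2
    v zero       = 1#
    v (suc zero) = - 1#

    Jv≈0 : InKernel F J v
    Jv≈0 u = begin
      ∑ F (λ j → J u j * v j) ≈⟨ ∑₂ (λ j → J u j * v j) ⟩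
      1# * 1# + 1# * - 1#     ≈⟨ +-cong (*-identityˡ 1#) (*-identityˡ (- 1#)) ⟩
      1# + - 1#               ≈⟨ -‿inverseʳ 1# ⟩
      0#                      ∎

mainTheorem7 : ∀ {c ℓ : Level} (F : Field c ℓ) → ArrowNu≡ F K₂ 1
mainTheorem7 F = (J F , J∈Q[K₂] F , J-ASAP , J-nullity≥1 F , nullity<2 F (J F) (1≉0 F))
                , λ B (diagonal≉0 , _) _ → nullity<2 F B (diagonal≉0 zero)
  where
  J-ASAP : ASAP F (J F)
  J-ASAP = nowhereZero⇒ASAP F (J F) (λ _ _ → 1≉0 F)
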